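{- The $2$-blowup of every non-unate simplex is non-minimal.
   Context: A clause is a conjunction of $k$ literals ($x$ or $\overline x$) on $k$ distinct variables; a formula is a set of clauses. A formula is simple if no two clauses use the same $k$-set of variables. A simplex is a simple $k$-SAT formula with $k+1$ variables and $k+1$ clauses. A formula is unate if each variable appears only as a positive literal or only as a negative literal. A formula is minimal if each clause $C$ has an assignment satisfying $C$ and no other clause. The $2$-blowup replaces each variable $x$ by duplicates $x,x'$ and each clause by all clauses obtained by choosing one duplicate for each of its variables (keeping signs). -}

module Defs where

open import Data.Nat using (ℕ; suc)
open import Data.Bool using (Bool; true; false; if_then_else_; _∨_)
open import Data.Maybe using (Maybe; just; nothing; is-just)
open import Data.Fin using (Fin)
open import Data.List using (List; length; map; allFin; foldr)
open import Data.Nat.ListAction using (sum)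
open import Data.List.Membership.Propositional using (_∈_)
open import Data.List.Relation.Unary.AllPairs using (AllPairs)
open import Data.Product using (Σ; _×_; ∃; _,_)
open import Relation.Nullary using (¬_)
open import Relation.Binary.PropositionalEquality using (_≡_; _≗_)

-- A clause over a variable type V is represented by its set of literals,
-- i.e. as a partial assignment: C x = just true  means literal x occurs,
-- C x = just false means literal x̄ occurs, C x = nothing means x is not used.
-- (A clause cannot contain both x and x̄ since its k variables are distinct.)
Clause : Set → Set
Clause V = V → Maybe Bool

Assignment : Set → Set
Assignment V = V → Bool

Sat : {V : Set} → Assignment V → Clause V → Set
Sat {V} α C = ∀ (x : V) (b : Bool) → C x ≡ just b → α x ≡ b

Formula : Set → Set₁
Formula V = Clause V → Set

Minimal : {V : Set} → Formula V → Set
Minimal {V} F = ∀ (C : Clause V) → F C →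
  Σ (Assignment V) λ α → Sat α C × (∀ (D : Clause V) → F D → Sat α D → D ≗ C)

ListFormula : ℕ → Set
ListFormula n = List (Clause (Fin n))

count : {n : ℕ} → (Fin n → Bool) → ℕ
count {n} p = sum (map (λ x → if p x then 1 else 0) (allFin n))

size : {n : ℕ} → Clause (Fin n) → ℕ
size C = count (λ x → is-just (C x))

numVars : {n : ℕ} → ListFormula n → ℕ
numVars F = count (λ x → foldr (λ C r → is-just (C x) ∨ r) false F)

IsKSAT : {n : ℕ} → ℕ → ListFormula n → Set
IsKSAT k F = ∀ C → C ∈ F → size C ≡ k

DistinctClauses : {n : ℕ} → ListFormula n → Set
DistinctClauses F = AllPairs (λ C D → ¬ (C ≗ D)) F

Simple : {n : ℕ} → ListFormula n → Set
Simple F = ∀ C D → C ∈ F → D ∈ F →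
  (∀ x → is-just (C x) ≡ is-just (D x)) → C ≗ D

IsSimplex : {n : ℕ} → ℕ → ListFormula n → Set
IsSimplex k F =
  DistinctClauses F × IsKSAT k F × Simple F ×
  numVars F ≡ suc k × length F ≡ suc k

Unate : {n : ℕ} → ListFormula n → Set
Unate {n} F = ¬ (Σ (Fin n) λ x → Σ (Clause (Fin n)) λ C → Σ (Clause (Fin n)) λ D →
  C ∈ F × D ∈ F × C x ≡ just true × D x ≡ just false)

pick : Bool → Bool → Maybe Bool → Maybe Bool
pick true  true  m = m
pick false false m = m
pick true  false m = nothing
pick false true  m = nothing

-- 2-blowup: variable x becomes (x , false) and (x , true); each clause C is
-- replaced by all clauses choosing one duplicate (given by s) per variable
blowupClause : {n : ℕ} → (Fin n → Bool) → Clause (Fin n) → Clause (Fin n × Bool)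
blowupClause s C (x , b) = pick (s x) b (C x)

Blowup2 : {n : ℕ} → ListFormula n → Formula (Fin n × Bool)
Blowup2 {n} F D = Σ (Clause (Fin n)) λ C → Σ (Fin n → Bool) λ s →
  C ∈ F × D ≗ blowupClause s C

module Submission where

-- In a simplex every clause omits exactly one of the k + 1 variables, and two
-- clauses omitting the same variable use the same variables, so by simplicity
-- they coincide; by pigeonhole every variable is omitted by some clause.  Let x
-- occur positively in C and negatively in D, and let E be the clause omitting x,
-- so E contains every other variable.  Take an assignment α satisfying the copy
-- of E built from the first duplicates (w , false) and no other clause of the
-- blowup.  For a variable w of E the two duplicates of w get opposite values
-- under α, since otherwise the copy of E switched to the second duplicate of w
-- would also be satisfied.  Hence whichever of C, D agrees with α on the first
-- duplicate of x has a copy satisfied by α; that copy contains a literal on x,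
-- while the copy of E does not.

open import Defs
open import Algebra.Properties.CommutativeSemigroup using (interchange)
open import Data.Bool using (Bool; true; false; not; _∧_; _∨_; _xor_; if_then_else_)
open import Data.Bool.Properties using (∧-identityʳ; ∧-zeroʳ; ∨-zeroʳ; ¬-not; xor-same)
import Data.Bool.Properties as Bool
open import Data.Fin using (Fin; zero; suc)
open import Data.Fin.Properties using (_≟_)
open import Data.List using (List; []; _∷_; length; map; allFin; tabulate; foldr)
open import Data.List.Properties using (map-tabulate; map-cong)
open import Data.List.Membership.Propositional using (_∈_; find; lose)
open import Data.List.Relation.Unary.Any using (here; there; any?)
import Data.List.Relation.Unary.All as All
open import Data.List.Relation.Unary.AllPairs using (AllPairs; []; _∷_)
open import Data.Maybe using (Maybe; just; nothing; is-just; maybe)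
open import Data.Maybe.Properties using (just-injective; ≡-dec)
open import Data.Nat using (ℕ; suc; _+_; _≤_; z≤n; s≤s)
open import Data.Nat.ListAction using (sum)
open import Data.Nat.Properties using (+-suc; +-comm; +-cancelˡ-≡; suc-injective; 0≢1+n; n≮n; +-commutativeSemigroup)
open import Data.Product using (∃-syntax; _×_; _,_; proj₁; proj₂)
open import Data.Sum using (_⊎_; inj₁; inj₂)
open import Data.Empty using (⊥-elim)
open import Function using (_∘_; id; const)
open import Relation.Nullary using (¬_; yes; no; does; contradiction)
open import Relation.Nullary.Decidable using (dec-true; dec-false)
open import Relation.Binary.PropositionalEquality
  using (_≡_; _≢_; _≗_; refl; sym; trans; cong; subst; subst₂; module ≡-Reasoning)

indicator : Bool → ℕ
indicator b = if b then 1 else 0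

sum-map-+ : ∀ {A : Set} (f g : A → ℕ) (xs : List A) →
  sum (map (λ x → f x + g x) xs) ≡ sum (map f xs) + sum (map g xs)
sum-map-+ f g [] = refl
sum-map-+ f g (x ∷ xs) =
  trans (cong (f x + g x +_) (sum-map-+ f g xs))
        (interchange +-commutativeSemigroup (f x) (g x) _ _)

count-suc : ∀ {n} (p : Fin (suc n) → Bool) →
  count p ≡ indicator (p zero) + count (p ∘ suc)
count-suc p = cong (λ xs → indicator (p zero) + sum xs)
  (trans (map-tabulate suc (indicator ∘ p)) (sym (map-tabulate id (indicator ∘ p ∘ suc))))

count-cong : ∀ {n} {p q : Fin n → Bool} → p ≗ q → count p ≡ count q
count-cong {n} p≗q = cong sum (map-cong (cong indicator ∘ p≗q) (allFin n))

indicator-split : ∀ a b → indicator a ≡ indicator (a ∧ b) + indicator (a ∧ not b)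
indicator-split false b     = refl
indicator-split true  false = refl
indicator-split true  true  = refl

count-split : ∀ {n} (p q : Fin n → Bool) →
  count p ≡ count (λ v → p v ∧ q v) + count (λ v → p v ∧ not (q v))
count-split {n} p q = begin
  count p
    ≡⟨ cong sum (map-cong (λ v → indicator-split (p v) (q v)) (allFin n)) ⟩
  sum (map (λ v → indicator (p v ∧ q v) + indicator (p v ∧ not (q v))) (allFin n))
    ≡⟨ sum-map-+ _ _ (allFin n) ⟩
  count (λ v → p v ∧ q v) + count (λ v → p v ∧ not (q v)) ∎
  where open ≡-Reasoning

_except_ : ∀ {n} → (Fin n → Bool) → Fin n → Fin n → Bool
(p except v) w = p w ∧ not (does (w ≟ v))

except-true : ∀ {n} (p : Fin n → Bool) {v w} → p w ≡ true → w ≢ v → (p except v) w ≡ true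
except-true p {v} {w} pw w≢v rewrite pw | dec-false (w ≟ v) w≢v = refl

count-except : ∀ {n} (p : Fin n → Bool) {v} → p v ≡ true → count p ≡ suc (count (p except v))
count-except {suc n} p {zero} pv
  rewrite count-suc p | count-suc (p except zero) | pv =
  cong suc (count-cong (λ w → sym (∧-identityʳ (p (suc w)))))
count-except {suc n} p {suc v} pv
  rewrite count-suc p | count-suc (p except suc v) | ∧-identityʳ (p zero) =
  trans (cong (indicator (p zero) +_) (count-except (p ∘ suc) pv)) (+-suc _ _)

count-witness : ∀ {n} (p : Fin n → Bool) {m} → count p ≡ suc m → ∃[ v ] p v ≡ true
count-witness {suc n} p eq with p zero in p₀ | count-suc p
... | true  | _    = zero , p₀
... | false | eq′ with count-witness (p ∘ suc) (trans (sym eq′) eq)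
...   | v , pv = suc v , pv

count≡1⇒unique : ∀ {n} (p : Fin n → Bool) {v w} → count p ≡ 1 → p v ≡ true → p w ≡ true → v ≡ w
count≡1⇒unique p {v} {w} count≡1 pv pw with w ≟ v
... | yes w≡v = sym w≡v
... | no w≢v = ⊥-elim (0≢1+n (trans (sym rest-empty) (count-except (p except v) (except-true p pw w≢v))))
  where
  rest-empty : count (p except v) ≡ 0
  rest-empty = suc-injective (trans (sym (count-except p pv)) count≡1)

length≤count : ∀ {n} {A : Set} {_≈_ : A → A → Set} (R : A → Fin n → Set) (q : Fin n → Bool)
  {xs : List A} → AllPairs (λ a b → ¬ a ≈ b) xs →
  (∀ {a} → a ∈ xs → ∃[ v ] R a v × q v ≡ true) →
  (∀ {a b v} → a ∈ xs → b ∈ xs → R a v → R b v → a ≈ b) →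
  length xs ≤ count q
length≤count R q [] _ _ = z≤n
length≤count R q {a ∷ xs} (a≉ ∷ distinct) image injective with image (here refl)
... | v , Rav , qv =
  subst (suc (length xs) ≤_) (sym (count-except q qv))
    (s≤s (length≤count R (q except v) distinct image′ (λ i j → injective (there i) (there j))))
  where
  image′ : ∀ {b} → b ∈ xs → ∃[ w ] R b w × (q except v) w ≡ true
  image′ b∈xs with image (there b∈xs)
  ... | w , Rbw , qw with w ≟ v
  ...   | yes refl = ⊥-elim (All.lookup a≉ b∈xs (injective (here refl) (there b∈xs) Rav Rbw))
  ...   | no w≢v  = w , Rbw , except-true q qw w≢v

occurs : ∀ {n} → ListFormula n → Fin n → Bool
occurs F x = foldr (λ C r → is-just (C x) ∨ r) false F

occurs-∈ : ∀ {n} {F : ListFormula n} {C x b} → C ∈ F → C x ≡ just b → occurs F x ≡ true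
occurs-∈ (here refl) Cx rewrite Cx = refl
occurs-∈ {F = D ∷ _} {x = x} (there C∈F) Cx rewrite occurs-∈ C∈F Cx = ∨-zeroʳ (is-just (D x))

occurs-∧-is-just : ∀ {n} {F : ListFormula n} {C} → C ∈ F →
  ∀ v → occurs F v ∧ is-just (C v) ≡ is-just (C v)
occurs-∧-is-just {F = F} {C} C∈F v with C v in Cv
... | just _  rewrite occurs-∈ C∈F Cv = refl
... | nothing = ∧-zeroʳ (occurs F v)

missed : ∀ {n} → ListFormula n → Clause (Fin n) → Fin n → Bool
missed F E v = occurs F v ∧ not (is-just (E v))

missed-intro : ∀ {n} {F : ListFormula n} {E v} → occurs F v ≡ true → E v ≡ nothing → missed F E v ≡ true
missed-intro o e rewrite o | e = refl

missed-elim : ∀ {n} {F : ListFormula n} {E v} → missed F E v ≡ true → occurs F v ≡ true × E v ≡ nothing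
missed-elim {F = F} {E} {v} m with occurs F v | E v
missed-elim () | false | _
missed-elim () | true  | just _
missed-elim _  | true  | nothing = refl , refl

module SimplexClauses {n k : ℕ} {F : ListFormula n}
  (ksat : IsKSAT k F) (simple : Simple F) (nvars : numVars F ≡ suc k) where

  missed-count : ∀ {E} → E ∈ F → count (missed F E) ≡ 1
  missed-count {E} E∈F = +-cancelˡ-≡ k _ _ (begin
    k + count (missed F E)
      ≡⟨ cong (_+ count (missed F E)) (trans (sym (ksat E E∈F)) clause-size) ⟩
    count (λ v → occurs F v ∧ is-just (E v)) + count (missed F E)
      ≡⟨ sym (count-split (occurs F) (is-just ∘ E)) ⟩
    count (occurs F)
      ≡⟨ nvars ⟩
    suc k
      ≡⟨ +-comm 1 k ⟩
    k + 1 ∎)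
    where
    open ≡-Reasoning
    clause-size : size E ≡ count (λ v → occurs F v ∧ is-just (E v))
    clause-size = count-cong (sym ∘ occurs-∧-is-just E∈F)

  missed-unique : ∀ {E v w} → E ∈ F → missed F E v ≡ true → missed F E w ≡ true → v ≡ w
  missed-unique E∈F = count≡1⇒unique _ (missed-count E∈F)

  variables-of-clause : ∀ {E v} → E ∈ F → missed F E v ≡ true →
    ∀ w → is-just (E w) ≡ (occurs F except v) w
  variables-of-clause {E} {v} E∈F Ev w with w ≟ v
  ... | yes refl rewrite proj₂ (missed-elim {F = F} {E} Ev) = sym (∧-zeroʳ (occurs F v))
  ... | no w≢v with E w in Ew
  ...   | just _  rewrite occurs-∈ E∈F Ew = refl
  ...   | nothing with occurs F w in ow
  ...     | false = refl
  ...     | true  = ⊥-elim (w≢v (missed-unique E∈F (missed-intro {F = F} {E} ow Ew) Ev))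

  missed-by-some-clause : DistinctClauses F → length F ≡ suc k →
    ∀ {x} → occurs F x ≡ true → ∃[ E ] E ∈ F × E x ≡ nothing
  missed-by-some-clause distinct len {x} ox with any? (λ E → ≡-dec Bool._≟_ (E x) nothing) F
  ... | yes some = find some
  ... | no none = ⊥-elim (n≮n k (subst₂ _≤_ len others≡k clauses≤others))
    where
    others≡k : count (occurs F except x) ≡ k
    others≡k = suc-injective (trans (sym (count-except (occurs F) ox)) nvars)

    image : ∀ {E} → E ∈ F → ∃[ v ] missed F E v ≡ true × (occurs F except x) v ≡ true
    image {E} E∈F with count-witness _ (missed-count E∈F)
    ... | v , Ev with v ≟ x | missed-elim {F = F} {E} Ev
    ...   | yes refl | _ , Ex = ⊥-elim (none (lose E∈F Ex))
    ...   | no v≢x   | ov , _ = v , Ev , except-true (occurs F) ov v≢x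

    clauses≤others : length F ≤ count (occurs F except x)
    clauses≤others = length≤count (λ E v → missed F E v ≡ true) (occurs F except x) distinct image
      λ {E} {E′} E∈F E′∈F Ev E′v → simple E E′ E∈F E′∈F λ w →
        trans (variables-of-clause E∈F Ev w) (sym (variables-of-clause E′∈F E′v w))

pick-same : ∀ s m → pick s s m ≡ m
pick-same true  m = refl
pick-same false m = refl

pick≡just⇒ : ∀ s c m {b} → pick s c m ≡ just b → s ≡ c × m ≡ just b
pick≡just⇒ true  true  m e = refl , e
pick≡just⇒ false false m e = refl , e

blowup-sat : ∀ {n} {α : Assignment (Fin n × Bool)} (s : Fin n → Bool) {G : Clause (Fin n)} →
  (∀ {w b} → G w ≡ just b → α (w , s w) ≡ b) → Sat α (blowupClause s G)
blowup-sat s {G} agrees (w , c) b e with pick≡just⇒ (s w) c (G w) e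
... | refl , Gw = agrees Gw

blowup-≗-just : ∀ {n} {s s′ : Fin n → Bool} {G E : Clause (Fin n)} →
  blowupClause s G ≗ blowupClause s′ E → ∀ {w b} → G w ≡ just b → s′ w ≡ s w × E w ≡ just b
blowup-≗-just {s = s} {s′} {G} {E} G≗E {w} {b} Gw = pick≡just⇒ (s′ w) (s w) (E w) (begin
  pick (s′ w) (s w) (E w) ≡⟨ sym (G≗E (w , s w)) ⟩
  pick (s w) (s w) (G w)  ≡⟨ pick-same (s w) (G w) ⟩
  G w                     ≡⟨ Gw ⟩
  just b                  ∎)
  where open ≡-Reasoning

Isolates : {V : Set} → Formula V → Assignment V → Clause V → Set
Isolates F α C = Sat α C × (∀ D → F D → Sat α D → D ≗ C)

copies-differ : ∀ {n} {F : ListFormula n} {E α} → E ∈ F →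
  Isolates (Blowup2 F) α (blowupClause (const false) E) →
  ∀ {w b} → E w ≡ just b → α (w , true) ≡ not b
copies-differ {n} {F} {E} {α} E∈F (sat₀ , isolated) {w} {b} Ew = ¬-not second≢b
  where
  switch-w : Fin n → Bool
  switch-w v = does (v ≟ w)

  second≢b : α (w , true) ≢ b
  second≢b second≡b = contradiction (trans switched (dec-true (w ≟ w) refl)) λ ()
    where
    agrees : ∀ {v b′} → E v ≡ just b′ → α (v , switch-w v) ≡ b′
    agrees {v} Ev with v ≟ w
    ... | yes refl = trans second≡b (just-injective (trans (sym Ew) Ev))
    ... | no _     = sat₀ (v , false) _ Ev

    switched : false ≡ switch-w w
    switched = proj₁ (blowup-≗-just {s = switch-w} {const false}
      (isolated _ (E , switch-w , E∈F , λ _ → refl) (blowup-sat switch-w agrees)) Ew)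

copy-agreeing : (f : Bool → Bool) (b : Bool) → f false ≡ b ⊎ f true ≡ not (f false) →
  f (f false xor b) ≡ b
copy-agreeing f b (inj₁ refl) = cong f (xor-same (f false))
copy-agreeing f b (inj₂ f₁) with f false in f₀ | b
... | true  | true  = f₀
... | true  | false = f₁
... | false | true  = f₁
... | false | false = f₀

no-isolating-assignment : ∀ {n} {F : ListFormula n} {x E G α} → E ∈ F → G ∈ F →
  E x ≡ nothing → G x ≡ just (α (x , false)) →
  (∀ {w} → occurs F w ≡ true → E w ≡ nothing → w ≡ x) →
  ¬ Isolates (Blowup2 F) α (blowupClause (const false) E)
no-isolating-assignment {n} {F} {x} {E} {G} {α} E∈F G∈F Ex Gx misses-only-x iso@(_ , isolated) =
  contradiction (trans (sym Ex) (proj₂ (blowup-≗-just {s = s} {const false} copy≗base Gx))) λ ()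
  where
  -- for each variable of G, a duplicate on which α agrees with the literal of G
  s : Fin n → Bool
  s w = maybe (α (w , false) xor_) false (G w)

  agrees : ∀ {w b} → G w ≡ just b → α (w , s w) ≡ b
  agrees {w} {b} Gw rewrite Gw = copy-agreeing (λ c → α (w , c)) b copies
    where
    copies : α (w , false) ≡ b ⊎ α (w , true) ≡ not (α (w , false))
    copies with E w in Ew
    ... | just b₀ = inj₂ (trans (copies-differ E∈F iso Ew) (cong not (sym (proj₁ iso (w , false) b₀ Ew))))
    ... | nothing with misses-only-x (occurs-∈ {x = w} G∈F Gw) Ew
    ...   | refl = inj₁ (just-injective (trans (sym Gx) Gw))

  copy≗base : blowupClause s G ≗ blowupClause (const false) E
  copy≗base = isolated _ (G , s , G∈F , λ _ → refl) (blowup-sat s agrees)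

blowup-not-minimal : ∀ {n} {F : ListFormula n} {x E C D} → E ∈ F → C ∈ F → D ∈ F →
  E x ≡ nothing → C x ≡ just true → D x ≡ just false →
  (∀ {w} → occurs F w ≡ true → E w ≡ nothing → w ≡ x) →
  ¬ Minimal (Blowup2 F)
blowup-not-minimal {x = x} {E} E∈F C∈F D∈F Ex Cx Dx misses-only-x minimal
  with minimal (blowupClause (const false) E) (E , const false , E∈F , λ _ → refl)
... | α , iso with α (x , false) in αx
...   | true  = no-isolating-assignment E∈F C∈F Ex (trans Cx (cong just (sym αx))) misses-only-x iso
...   | false = no-isolating-assignment E∈F D∈F Ex (trans Dx (cong just (sym αx))) misses-only-x iso

lemma5p5 : ∀ (n k : ℕ) (F : ListFormula n) → IsSimplex k F → ¬ Unate F →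
    ¬ Minimal (Blowup2 F)
lemma5p5 n k F (distinct , ksat , simple , nvars , len) non-unate minimal =
  non-unate λ (x , C , D , C∈F , D∈F , Cx , Dx) →
    let x-occurs = occurs-∈ {x = x} C∈F Cx
        E , E∈F , Ex = missed-by-some-clause distinct len x-occurs
        misses-only-x : ∀ {w} → occurs F w ≡ true → E w ≡ nothing → w ≡ x
        misses-only-x w-occurs Ew = missed-unique E∈F
          (missed-intro {F = F} {E} w-occurs Ew) (missed-intro {F = F} {E} x-occurs Ex)
    in blowup-not-minimal E∈F C∈F D∈F Ex Cx Dx misses-only-x minimal
  where open SimplexClauses ksat simple nvars
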